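{- Let $\Sigma$ be a finite set and $J,T$ positive integers. Let $G$ be the graph on $\Sigma^J$ in which two vertices are adjacent iff their Hamming distance is exactly $1$; an edge has direction $j$ if its endpoints differ in coordinate $j$. Let an arbitrary set of edges be bad, and for $j\in[J]$ let $\lambda_j$ be the fraction of edges in direction $j$ that are bad (equivalently $\lambda_j=\mathbb P((v,w)\text{ bad})$ where $v$ is uniform on $\Sigma^J$ and $w$ is obtained from $v$ by replacing $v_j$ with a uniform element of $\Sigma\setminus\{v_j\}$). Let $\sigma:[T]\to[J]$ be arbitrary, and consider the random walk $v^{(0)},\dots,v^{(T)}$ with $v^{(0)}$ uniform on $\Sigma^J$ and $v^{(t)}$ obtained from $v^{(t-1)}$ by resampling coordinate $\sigma(t)$ uniformly from $\Sigma$. Then with probability at least $|\Sigma|^{ -\sum_{t=1}^T\lambda_{\sigma(t)}}$, no step of the walk traverses a bad edge (steps where the walk does not move are regarded as not traversing a bad edge). -}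

module Defs where

open import Data.Nat using (ℕ; zero; suc; _+_; _*_; _∸_; _^_)
open import Data.Bool using (Bool; true; false; _∧_; _∨_; not)
open import Data.Fin using (Fin) renaming (_≟_ to _≟F_)
import Data.Fin as F
open import Data.List using (List; []; _∷_; [_]; map; concatMap; allFin)
open import Data.Nat.ListAction using (sum)
open import Data.Vec using (Vec; []; _∷_; lookup; _[_]≔_)
open import Data.Vec.Properties using (≡-dec)
open import Data.Product using (_×_; _,_)
open import Relation.Nullary.Decidable using (⌊_⌋)

-- The alphabet Σ is modelled as Fin q (q = |Σ|); vertices of G are Vec (Fin q) J.
Word : ℕ → ℕ → Set
Word q J = Vec (Fin q) J

allWords : (q n : ℕ) → List (Word q n)
allWords q zero    = [ [] ]
allWords q (suc n) = concatMap (λ x → map (x ∷_) (allWords q n)) (allFin q)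

countB : {A : Set} → (A → Bool) → List A → ℕ
countB p []       = 0
countB p (x ∷ xs) with p x
... | true  = suc (countB p xs)
... | false = countB p xs

eqW : {q J : ℕ} → Word q J → Word q J → Bool
eqW v w = ⌊ ≡-dec _≟F_ v w ⌋

dirEdge : {q J : ℕ} → Fin J → Word q J → Word q J → Bool
dirEdge j v w = not ⌊ lookup v j ≟F lookup w j ⌋ ∧ eqW w (v [ j ]≔ lookup w j)

pairs : {A : Set} → List A → List (A × A)
pairs xs = concatMap (λ x → map (x ,_) xs) xs

badDir : (q J : ℕ) → (Word q J → Word q J → Bool) → Fin J → ℕ
badDir q J bad j =
  countB (λ { (v , w) → dirEdge j v w ∧ bad v w }) (pairs (allWords q J))

-- number of ordered pairs (v , w) forming an edge in direction j (same for all j)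
dirTotal : (q J : ℕ) → ℕ
dirTotal q J = q ^ J * (q ∸ 1)
-- so λ_j = badDir q J bad j / dirTotal q J

-- numerator of Σ_{t=1}^T λ_{σ(t)} over the common denominator dirTotal q J
badSum : (q J T : ℕ) → (Word q J → Word q J → Bool) → (Fin T → Fin J) → ℕ
badSum q J T bad σ = sum (map (λ t → badDir q J bad (σ t)) (allFin T))

-- the walk from v with resampled values cs (c_t is the new value of coordinate σ(t))
-- traverses no bad edge (non-moving steps are fine)
goodWalk : {q J T : ℕ} → (Word q J → Word q J → Bool) →
           (Fin T → Fin J) → Word q J → Vec (Fin q) T → Bool
goodWalk bad σ v []       = true
goodWalk bad σ v (c ∷ cs) =
  (eqW v (v [ σ F.zero ]≔ c) ∨ not (bad v (v [ σ F.zero ]≔ c)))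
  ∧ goodWalk bad (λ t → σ (F.suc t)) (v [ σ F.zero ]≔ c) cs

-- number of (v⁽⁰⁾, c_1..c_T) among the q^J * q^T equally likely outcomes giving a good walk
goodCount : (q J T : ℕ) → (Word q J → Word q J → Bool) → (Fin T → Fin J) → ℕ
goodCount q J T bad σ =
  countB (λ { (v , cs) → goodWalk bad σ v cs })
         (concatMap (λ v → map (v ,_) (allWords q T)) (allWords q J))

{-# OPTIONS --safe #-}
module Submission where

-- For a word v let c(v) be the number of resampling sequences for which the walk from v traverses
-- no bad edge; the claim is a lower bound on Σ_v c(v).  Splitting off the first step expresses c
-- as T_j c′, where j = σ(1), c′ is the count for the remaining steps, and (T_j g)(v) sums
-- g(v[j := a]) over the symbols a for which the step from v is allowed (staying put included).
--
-- The key estimate is that T_j multiplies the geometric mean of g over all words by at least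
-- q^(1 - λ_j).  At a word v with d bad moves, weighted AM–GM with weight d + 1 on g(v) gives
--   q^q ∏_a g(v ⊳ a) ≤ (d + 1)^(d + 1) ((T_j g)(v))^q,
-- where v ⊳ a is v[j := a] if that move is good and v otherwise.  In the product over all v, a
-- good move and its reverse (good as well, since bad is symmetric) exchange their endpoints, so
-- the left-hand sides multiply to q^(q N) ∏_v g(v)^q; and ((d + 1)^(d + 1))^(q - 1) ≤ q^(q d),
-- the monotonicity of s^(s / (s - 1)), turns the loss into the number of bad edges in direction j.
-- Iterating from c = 1 and bounding the geometric mean of c by its arithmetic mean gives the
-- theorem.  All inequalities are raised to integral powers, so no roots or logarithms occur.

import Algebra.Properties.CommutativeSemigroup as CommutativeSemigroupProperties
open import Data.Bool using (Bool; true; false; not; _∧_; _∨_; if_then_else_)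
open import Data.Bool.Properties using (if-float; ∧-identityʳ; ∧-zeroʳ)
open import Data.Fin using (Fin) renaming (_≟_ to _≟F_)
import Data.Fin as Fin
open import Data.List
  using (List; []; _∷_; _++_; length; map; concatMap; cartesianProductWith; replicate; allFin)
open import Data.List.Properties
  using (map-++; length-++; length-map; length-replicate; length-tabulate; map-tabulate)
open import Data.List.Membership.Propositional using (_∈_)
open import Data.List.Membership.Propositional.Properties
  using (∈-map⁺; ∈-allFin; ∈-cartesianProductWith⁺)
open import Data.List.Membership.Propositional.Properties.WithK using (unique∧set⇒bag)
open import Data.List.Relation.Binary.BagAndSetEquality using (∼bag⇒↭)
open import Data.List.Relation.Binary.Permutation.Propositional using (_↭_)
open import Data.List.Relation.Binary.Permutation.Propositional.Properties using (map⁺)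
open import Data.List.Relation.Unary.All as All using (All; []; _∷_)
open import Data.List.Relation.Unary.AllPairs using ([]; _∷_)
open import Data.List.Relation.Unary.Any using (here; there)
open import Data.List.Relation.Unary.Unique.Propositional using (Unique)
import Data.List.Relation.Unary.Unique.Propositional.Properties as Unique
open import Data.Nat
open import Data.Nat.ListAction using (sum; product)
open import Data.Nat.ListAction.Properties using (sum-++; product-++; product-↭)
open import Data.Nat.Properties
open import Data.Nat.Tactic.RingSolver using (solve-∀)
open import Data.Product using (_×_; _,_; proj₁; ∃; ∃₂)
open import Data.Product.Properties using (,-injectiveˡ; ,-injectiveʳ)
open import Data.Sum using (_⊎_; inj₁; inj₂)
open import Data.Vec using ([]; _∷_; lookup; _[_]≔_)
open import Data.Vec.Properties
  using (≡-dec; ∷-injective; []≔-lookup; []≔-idempotent; lookup∘update)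
open import Function using (_∘_; id; mk⇔)
open import Relation.Binary.Definitions using (DecidableEquality)
open import Relation.Binary.PropositionalEquality
open import Relation.Nullary using (Dec; yes; no; ¬_; contradiction)
open import Relation.Nullary.Decidable using (⌊_⌋; isYes≗does; dec-true; dec-false)
open import Defs

open CommutativeSemigroupProperties +-commutativeSemigroup
  using () renaming (interchange to +-interchange)
open CommutativeSemigroupProperties *-commutativeSemigroup
  using () renaming (interchange to *-interchange; x∙yz≈y∙xz to *-left-comm)

private variable
  A B C : Set
  xs : List A

-- AM–GM

^-distribʳ-* : ∀ m n o → (m * n) ^ o ≡ m ^ o * n ^ o
^-distribʳ-* m n zero    = refl
^-distribʳ-* m n (suc o) = begin
  m * n * (m * n) ^ o      ≡⟨ cong (m * n *_) (^-distribʳ-* m n o) ⟩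
  m * n * (m ^ o * n ^ o)  ≡⟨ *-interchange m n (m ^ o) (n ^ o) ⟩
  m * m ^ o * (n * n ^ o)  ∎
  where open ≡-Reasoning

^-^-comm : ∀ m n o → (m ^ n) ^ o ≡ (m ^ o) ^ n
^-^-comm m n o = trans (^-*-assoc m n o) (trans (cong (m ^_) (*-comm n o)) (sym (^-*-assoc m o n)))

^-cancelʳ-≤ : ∀ n .{{_ : NonZero n}} {m o} → m ^ n ≤ o ^ n → m ≤ o
^-cancelʳ-≤ n {m} {o} mⁿ≤oⁿ with m ≤? o
... | yes m≤o = m≤o
... | no  m≰o = contradiction mⁿ≤oⁿ (<⇒≱ (^-monoˡ-< n (≰⇒> m≰o)))

rearrangement : ∀ {a b c d} → a ≤ b → c ≤ d → a * d + b * c ≤ a * c + b * d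
rearrangement {a} {b} {c} {d} a≤b c≤d
  with k , refl ← m≤n⇒∃[o]m+o≡n a≤b | l , refl ← m≤n⇒∃[o]m+o≡n c≤d =
  subst (a * (c + l) + (a + k) * c ≤_) (expand a c k l) (m≤m+n _ (k * l))
  where
  expand : ∀ a c k l → a * (c + l) + (a + k) * c + k * l ≡ a * c + (a + k) * (c + l)
  expand = solve-∀

power-rearrangement : ∀ k x y → x * y ^ k + y * x ^ k ≤ x * x ^ k + y * y ^ k
power-rearrangement k x y with ≤-total x y
... | inj₁ x≤y = rearrangement x≤y (^-monoˡ-≤ k x≤y)
... | inj₂ y≤x = subst₂ _≤_ (+-comm (y * x ^ k) (x * y ^ k)) (+-comm (y * y ^ k) (x * x ^ k))
                        (rearrangement y≤x (^-monoˡ-≤ k y≤x))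

amgm₂ : ∀ n x y → suc n * x * y ^ n ≤ x ^ suc n + n * y ^ suc n
amgm₂ zero    x y = ≤-reflexive (trans (cong (_* 1) (+-identityʳ x)) (sym (+-identityʳ (x * 1))))
amgm₂ (suc n) x y = begin
  suc (suc n) * x * y ^ suc n
    ≡⟨ split n x y (y ^ n) ⟩
  x * y ^ suc n + suc n * x * y ^ n * y
    ≤⟨ +-monoʳ-≤ (x * y ^ suc n) (*-monoˡ-≤ y (amgm₂ n x y)) ⟩
  x * y ^ suc n + (x ^ suc n + n * y ^ suc n) * y
    ≡⟨ regroup n x y (y ^ n) (x ^ suc n) ⟩
  (x * y ^ suc n + y * x ^ suc n) + n * y ^ suc (suc n)
    ≤⟨ +-monoˡ-≤ (n * y ^ suc (suc n)) (power-rearrangement (suc n) x y) ⟩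
  (x * x ^ suc n + y * y ^ suc n) + n * y ^ suc (suc n)
    ≡⟨ +-assoc (x * x ^ suc n) (y * y ^ suc n) (n * y ^ suc (suc n)) ⟩
  x ^ suc (suc n) + suc n * y ^ suc (suc n) ∎
  where
  open ≤-Reasoning
  split : ∀ n x y yⁿ → suc (suc n) * x * (y * yⁿ) ≡ x * (y * yⁿ) + suc n * x * yⁿ * y
  split = solve-∀
  regroup : ∀ n x y yⁿ xⁿ⁺¹ → x * (y * yⁿ) + (xⁿ⁺¹ + n * (y * yⁿ)) * y
                              ≡ (x * (y * yⁿ) + y * xⁿ⁺¹) + n * (y * (y * yⁿ))
  regroup = solve-∀

-- amgm₂ at x = n (a + s) and y = (1 + n) s, with the term n (1 + n) ^ (1 + n) s ^ (1 + n)
-- cancelled from both sides.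
amgm-step : ∀ n a s → suc n ^ suc n * s ^ n * a ≤ n ^ n * (a + s) ^ suc n
amgm-step zero      a s = subst₂ _≤_ (unitˡ a) (unitʳ (a + s)) (m≤m+n a s)
  where
  unitˡ : ∀ x → x ≡ 1 * 1 * 1 * x
  unitˡ = solve-∀
  unitʳ : ∀ x → x ≡ 1 * (x * 1)
  unitʳ = solve-∀
amgm-step n@(suc _) a s = *-cancelˡ-≤ n (+-cancelʳ-≤ common _ _ (begin
  n * (suc n ^ suc n * s ^ n * a) + common
    ≡⟨ expand n a s (suc n ^ n) (s ^ n) ⟩
  suc n * (n * (a + s)) * (suc n ^ n * s ^ n)
    ≡⟨ cong (suc n * (n * (a + s)) *_) (^-distribʳ-* (suc n) s n) ⟨
  suc n * (n * (a + s)) * (suc n * s) ^ n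
    ≤⟨ amgm₂ n (n * (a + s)) (suc n * s) ⟩
  (n * (a + s)) ^ suc n + n * (suc n * s) ^ suc n
    ≡⟨ cong₂ _+_ (^-distribʳ-* n (a + s) (suc n)) (cong (n *_) (^-distribʳ-* (suc n) s (suc n))) ⟩
  n * n ^ n * (a + s) ^ suc n + common
    ≡⟨ cong (_+ common) (*-assoc n (n ^ n) ((a + s) ^ suc n)) ⟩
  n * (n ^ n * (a + s) ^ suc n) + common ∎))
  where
  open ≤-Reasoning
  common = n * (suc n ^ suc n * s ^ suc n)
  expand : ∀ n a s P S →
           n * (suc n * P * S * a) + n * (suc n * P * (s * S)) ≡ suc n * (n * (a + s)) * (P * S)
  expand = solve-∀

amgm : ∀ xs → length xs ^ length xs * product xs ≤ sum xs ^ length xs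
amgm []               = ≤-refl
amgm (x ∷ [])         = ≤-reflexive (singleton x)
  where
  singleton : ∀ x → 1 * 1 * (x * 1) ≡ (x + 0) * 1
  singleton = solve-∀
amgm (x ∷ xs@(_ ∷ _)) = *-cancelˡ-≤ (n ^ n) {{m^n≢0 n n}} (begin
  n ^ n * (suc n ^ suc n * (x * product xs))
    ≡⟨ reorder (n ^ n) (suc n ^ suc n) x (product xs) ⟩
  suc n ^ suc n * (n ^ n * product xs) * x
    ≤⟨ *-monoˡ-≤ x (*-monoʳ-≤ (suc n ^ suc n) (amgm xs)) ⟩
  suc n ^ suc n * sum xs ^ n * x
    ≤⟨ amgm-step n x (sum xs) ⟩
  n ^ n * (x + sum xs) ^ suc n ∎)
  where
  open ≤-Reasoning
  n = length xs
  reorder : ∀ a b c d → a * (b * (c * d)) ≡ b * (a * d) * c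
  reorder = solve-∀

sum-replicate : ∀ n x → sum (replicate n x) ≡ n * x
sum-replicate zero    x = refl
sum-replicate (suc n) x = cong (x +_) (sum-replicate n x)

product-replicate : ∀ n x → product (replicate n x) ≡ x ^ n
product-replicate zero    x = refl
product-replicate (suc n) x = cong (x *_) (product-replicate n x)

-- AM–GM for b copies of q = 1 + a + b and q * a copies of 1, whose mean is q / (1 + a).
amgm-selfPower : ∀ a b .{{_ : NonZero (a + b)}} →
                 suc a ^ (suc a * (a + b)) * (suc a + b) ^ b ≤ (suc a + b) ^ (suc a * (a + b))
amgm-selfPower a b = *-cancelˡ-≤ (c ^ (s * c)) {{m^n≢0 c (s * c)}} (begin
  c ^ (s * c) * (s ^ (s * c) * q ^ b)
    ≡⟨ *-left-comm (c ^ (s * c)) (s ^ (s * c)) (q ^ b) ⟩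
  s ^ (s * c) * (c ^ (s * c) * q ^ b)
    ≡⟨ *-assoc (s ^ (s * c)) (c ^ (s * c)) (q ^ b) ⟨
  s ^ (s * c) * c ^ (s * c) * q ^ b
    ≡⟨ cong (_* q ^ b) (^-distribʳ-* s c (s * c)) ⟨
  (s * c) ^ (s * c) * q ^ b
    ≡⟨ cong₂ (λ n p → n ^ n * p) length-entries product-entries ⟨
  length entries ^ length entries * product entries
    ≤⟨ amgm entries ⟩
  sum entries ^ length entries
    ≡⟨ cong₂ _^_ sum-entries length-entries ⟩
  (q * c) ^ (s * c)
    ≡⟨ trans (^-distribʳ-* q c (s * c)) (*-comm (q ^ (s * c)) (c ^ (s * c))) ⟩
  c ^ (s * c) * q ^ (s * c) ∎)
  where
  open ≤-Reasoning
  c = a + b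
  s = suc a
  q = s + b
  entries = replicate b q ++ replicate (q * a) 1
  length-entries : length entries ≡ s * c
  length-entries = trans (length-++ (replicate b q))
    (trans (cong₂ _+_ (length-replicate b) (length-replicate (q * a))) (count a b))
    where
    count : ∀ a b → b + (suc a + b) * a ≡ suc a * (a + b)
    count = solve-∀
  sum-entries : sum entries ≡ q * c
  sum-entries = trans (sum-++ (replicate b q) (replicate (q * a) 1))
    (trans (cong₂ _+_ (sum-replicate b q) (sum-replicate (q * a) 1)) (total a b))
    where
    total : ∀ a b → b * (suc a + b) + (suc a + b) * a * 1 ≡ (suc a + b) * (a + b)
    total = solve-∀
  product-entries : product entries ≡ q ^ b
  product-entries = trans (product-++ (replicate b q) (replicate (q * a) 1))
    (trans (cong₂ _*_ (product-replicate b q) (trans (product-replicate (q * a) 1) (^-zeroˡ (q * a))))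
           (*-identityʳ (q ^ b)))

-- Equivalently, s ^ (s / (s - 1)) is increasing in s.
selfPower-mono : ∀ {s q} .{{_ : NonZero s}} → s ≤ q → (s ^ s) ^ (q ∸ 1) ≤ q ^ (q * (s ∸ 1))
selfPower-mono {suc zero} {suc b} _ = ≤-trans (≤-reflexive (^-zeroˡ b)) (m^n>0 (suc b) (suc b * 0))
selfPower-mono {s@(suc a@(suc _))} s≤q with b , refl ← m≤n⇒∃[o]m+o≡n s≤q = begin
  (s ^ s) ^ (a + b)  ≡⟨ ^-*-assoc s s (a + b) ⟩
  s ^ (s * (a + b))  ≤⟨ *-cancelʳ-≤ _ _ (q ^ b) {{m^n≢0 q b}} sˢᶜqᵇ≤qᵠᵃqᵇ ⟩
  q ^ (q * a)        ∎
  where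
  open ≤-Reasoning
  q = s + b
  sˢᶜqᵇ≤qᵠᵃqᵇ : s ^ (s * (a + b)) * q ^ b ≤ q ^ (q * a) * q ^ b
  sˢᶜqᵇ≤qᵠᵃqᵇ = begin
    s ^ (s * (a + b)) * q ^ b  ≤⟨ amgm-selfPower a b ⟩
    q ^ (s * (a + b))          ≡⟨ cong (q ^_) (exponent a b) ⟩
    q ^ (q * a + b)            ≡⟨ ^-distribˡ-+-* q (q * a) b ⟩
    q ^ (q * a) * q ^ b        ∎
    where
    exponent : ∀ a b → suc a * (a + b) ≡ (suc a + b) * a + b
    exponent = solve-∀

-- Sums and products over lists

∑ : List A → (A → ℕ) → ℕ
∑ xs f = sum (map f xs)

∏ : List A → (A → ℕ) → ℕ
∏ xs f = product (map f xs)

∑-cong : ∀ xs {f g : A → ℕ} → (∀ x → f x ≡ g x) → ∑ xs f ≡ ∑ xs g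
∑-cong []       f≗g = refl
∑-cong (x ∷ xs) f≗g = cong₂ _+_ (f≗g x) (∑-cong xs f≗g)

∏-cong : ∀ xs {f g : A → ℕ} → (∀ x → f x ≡ g x) → ∏ xs f ≡ ∏ xs g
∏-cong []       f≗g = refl
∏-cong (x ∷ xs) f≗g = cong₂ _*_ (f≗g x) (∏-cong xs f≗g)

∏-mono-≤ : ∀ xs {f g : A → ℕ} → (∀ x → f x ≤ g x) → ∏ xs f ≤ ∏ xs g
∏-mono-≤ []       f≤g = ≤-refl
∏-mono-≤ (x ∷ xs) f≤g = *-mono-≤ (f≤g x) (∏-mono-≤ xs f≤g)

∑-zero : ∀ (xs : List A) → ∑ xs (λ _ → 0) ≡ 0
∑-zero []       = refl
∑-zero (x ∷ xs) = ∑-zero xs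

∑-+ : ∀ xs (f g : A → ℕ) → ∑ xs (λ x → f x + g x) ≡ ∑ xs f + ∑ xs g
∑-+ []       f g = refl
∑-+ (x ∷ xs) f g = trans (cong (f x + g x +_) (∑-+ xs f g)) (+-interchange (f x) (g x) _ _)

∏-* : ∀ xs (f g : A → ℕ) → ∏ xs (λ x → f x * g x) ≡ ∏ xs f * ∏ xs g
∏-* []       f g = refl
∏-* (x ∷ xs) f g = trans (cong (f x * g x *_) (∏-* xs f g)) (*-interchange (f x) (g x) _ _)

∑-*ˡ : ∀ xs k (f : A → ℕ) → ∑ xs (λ x → k * f x) ≡ k * ∑ xs f
∑-*ˡ []       k f = sym (*-zeroʳ k)
∑-*ˡ (x ∷ xs) k f = trans (cong (k * f x +_) (∑-*ˡ xs k f)) (sym (*-distribˡ-+ k (f x) _))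

∑-*ʳ : ∀ xs (f : A → ℕ) k → ∑ xs (λ x → f x * k) ≡ ∑ xs f * k
∑-*ʳ []       f k = refl
∑-*ʳ (x ∷ xs) f k = trans (cong (f x * k +_) (∑-*ʳ xs f k)) (sym (*-distribʳ-+ k (f x) _))

∏-const : ∀ xs k → ∏ xs (λ (_ : A) → k) ≡ k ^ length xs
∏-const []       k = refl
∏-const (x ∷ xs) k = cong (k *_) (∏-const xs k)

∏-^ : ∀ xs (f : A → ℕ) k → ∏ xs (λ x → f x ^ k) ≡ ∏ xs f ^ k
∏-^ []       f k = sym (^-zeroˡ k)
∏-^ (x ∷ xs) f k = trans (cong (f x ^ k *_) (∏-^ xs f k)) (sym (^-distribʳ-* (f x) (∏ xs f) k))

∏-^-∑ : ∀ xs b (f : A → ℕ) → ∏ xs (λ x → b ^ f x) ≡ b ^ ∑ xs f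
∏-^-∑ []       b f = refl
∏-^-∑ (x ∷ xs) b f = trans (cong (b ^ f x *_) (∏-^-∑ xs b f)) (sym (^-distribˡ-+-* b (f x) _))

∑-comm : ∀ xs (ys : List B) (f : A → B → ℕ) →
         ∑ xs (λ x → ∑ ys (f x)) ≡ ∑ ys (λ y → ∑ xs (λ x → f x y))
∑-comm []       ys f = sym (∑-zero ys)
∑-comm (x ∷ xs) ys f = trans (cong (∑ ys (f x) +_) (∑-comm xs ys f))
                             (sym (∑-+ ys (f x) (λ y → ∑ xs (λ x → f x y))))

∑-concatMap : ∀ (g : A → List B) xs (f : B → ℕ) →
              ∑ (concatMap g xs) f ≡ ∑ xs (λ x → ∑ (g x) f)
∑-concatMap g []       f = refl
∑-concatMap g (x ∷ xs) f = trans (cong sum (map-++ f (g x) _))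
  (trans (sum-++ (map f (g x)) _) (cong (∑ (g x) f +_) (∑-concatMap g xs f)))

∏-concatMap : ∀ (g : A → List B) xs (f : B → ℕ) →
              ∏ (concatMap g xs) f ≡ ∏ xs (λ x → ∏ (g x) f)
∏-concatMap g []       f = refl
∏-concatMap g (x ∷ xs) f = trans (cong product (map-++ f (g x) _))
  (trans (product-++ (map f (g x)) _) (cong (∏ (g x) f *_) (∏-concatMap g xs f)))

∏-map : ∀ (h : A → B) xs (f : B → ℕ) → ∏ (map h xs) f ≡ ∏ xs (f ∘ h)
∏-map h []       f = refl
∏-map h (x ∷ xs) f = cong (f (h x) *_) (∏-map h xs f)

countB-∑ : ∀ (p : A → Bool) xs → countB p xs ≡ ∑ xs (λ x → if p x then 1 else 0)
countB-∑ p []       = refl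
countB-∑ p (x ∷ xs) with p x
... | true  = cong suc (countB-∑ p xs)
... | false = countB-∑ p xs

∑-if : ∀ (p : A → Bool) xs k → ∑ xs (λ x → if p x then k else 0) ≡ countB p xs * k
∑-if p []       k = refl
∑-if p (x ∷ xs) k with p x
... | true  = cong (k +_) (∑-if p xs k)
... | false = ∑-if p xs k

∏-if : ∀ (p : A → Bool) xs k → ∏ xs (λ x → if p x then k else 1) ≡ k ^ countB p xs
∏-if p []       k = refl
∏-if p (x ∷ xs) k with p x
... | true  = cong (k *_) (∏-if p xs k)
... | false = trans (+-identityʳ _) (∏-if p xs k)

countB-partition : ∀ (p : A → Bool) xs → countB p xs + countB (not ∘ p) xs ≡ length xs
countB-partition p []       = refl
countB-partition p (x ∷ xs) with p x
... | true  = cong suc (countB-partition p xs)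
... | false = trans (+-suc _ _) (cong suc (countB-partition p xs))

countB-map : ∀ (p : B → Bool) (h : A → B) xs → countB p (map h xs) ≡ countB (p ∘ h) xs
countB-map p h []       = refl
countB-map p h (x ∷ xs) with p (h x)
... | true  = cong suc (countB-map p h xs)
... | false = countB-map p h xs

countB-concatMap : ∀ (p : B → Bool) (g : A → List B) xs →
                   countB p (concatMap g xs) ≡ ∑ xs (λ x → countB p (g x))
countB-concatMap p g xs = begin
  countB p (concatMap g xs)                          ≡⟨ countB-∑ p (concatMap g xs) ⟩
  ∑ (concatMap g xs) (λ y → if p y then 1 else 0)    ≡⟨ ∑-concatMap g xs _ ⟩
  ∑ xs (λ x → ∑ (g x) (λ y → if p y then 1 else 0))  ≡⟨ ∑-cong xs (λ x → countB-∑ p (g x)) ⟨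
  ∑ xs (λ x → countB p (g x))                        ∎
  where open ≡-Reasoning

countB-∧ : ∀ b (p : A → Bool) xs → countB (λ x → b ∧ p x) xs ≡ (if b then countB p xs else 0)
countB-∧ true  p xs       = refl
countB-∧ false p []       = refl
countB-∧ false p (x ∷ xs) = countB-∧ false p xs

amgm-∑∏ : ∀ xs (f : A → ℕ) → length xs ^ length xs * ∏ xs f ≤ ∑ xs f ^ length xs
amgm-∑∏ xs f = subst (λ n → n ^ n * ∏ xs f ≤ ∑ xs f ^ n) (length-map f xs) (amgm (map f xs))

-- AM–GM for x / (1 + s) taken 1 + s times and the y c with p c, cleared of denominators;
-- the proof applies amgm to u c = (1 + s) * y c for p c and u c = x otherwise.
amgm-weighted : ∀ (xs : List A) (p : A → Bool) (y : A → ℕ) x {s} → countB (not ∘ p) xs ≡ suc s →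
                length xs ^ length xs * ∏ xs (λ c → if p c then y c else x)
                  ≤ suc s ^ suc s * (x + ∑ xs (λ c → if p c then y c else 0)) ^ length xs
amgm-weighted {A = A} xs p y x {s} #¬p≡t = *-cancelˡ-≤ (t ^ k) {{m^n≢0 t k}} (begin
  t ^ k * (n ^ n * P)                 ≡⟨ *-left-comm (t ^ k) (n ^ n) P ⟩
  n ^ n * (t ^ k * P)                 ≡⟨ cong₂ (λ m Q → m ^ m * Q) (length-map u xs) ∏u ⟨
  length us ^ length us * product us  ≤⟨ amgm us ⟩
  sum us ^ length us                  ≡⟨ cong₂ _^_ ∑u (length-map u xs) ⟩
  (t * (x + Y)) ^ n                   ≡⟨ ^-distribʳ-* t (x + Y) n ⟩
  t ^ n * (x + Y) ^ n                 ≡⟨ cong (λ m → t ^ m * (x + Y) ^ n) n≡k+t ⟩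
  t ^ (k + t) * (x + Y) ^ n           ≡⟨ cong (_* (x + Y) ^ n) (^-distribˡ-+-* t k t) ⟩
  t ^ k * t ^ t * (x + Y) ^ n         ≡⟨ *-assoc (t ^ k) (t ^ t) ((x + Y) ^ n) ⟩
  t ^ k * (t ^ t * (x + Y) ^ n)       ∎)
  where
  open ≤-Reasoning
  t = suc s
  n = length xs
  k = countB p xs
  P = ∏ xs (λ c → if p c then y c else x)
  Y = ∑ xs (λ c → if p c then y c else 0)
  u : A → ℕ
  u c = if p c then t * y c else x
  us = map u xs
  n≡k+t : n ≡ k + t
  n≡k+t = trans (sym (countB-partition p xs)) (cong (k +_) #¬p≡t)
  ∑u : sum us ≡ t * (x + Y)
  ∑u = begin-equality
    ∑ xs u
      ≡⟨ ∑-cong xs split ⟩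
    ∑ xs (λ c → t * (if p c then y c else 0) + (if not (p c) then x else 0))
      ≡⟨ ∑-+ xs _ _ ⟩
    ∑ xs (λ c → t * (if p c then y c else 0)) + ∑ xs (λ c → if not (p c) then x else 0)
      ≡⟨ cong₂ _+_ (∑-*ˡ xs t _) (trans (∑-if (not ∘ p) xs x) (cong (_* x) #¬p≡t)) ⟩
    t * Y + t * x
      ≡⟨ trans (+-comm (t * Y) (t * x)) (sym (*-distribˡ-+ t x Y)) ⟩
    t * (x + Y) ∎
    where
    split : ∀ c → u c ≡ t * (if p c then y c else 0) + (if not (p c) then x else 0)
    split c with p c
    ... | true  = sym (+-identityʳ _)
    ... | false = cong (_+ x) (sym (*-zeroʳ t))
  ∏u : ∏ xs u ≡ t ^ k * P
  ∏u = trans (∏-cong xs split) (trans (∏-* xs _ _) (cong (_* P) (∏-if p xs t)))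
    where
    split : ∀ c → u c ≡ (if p c then t else 1) * (if p c then y c else x)
    split c with p c
    ... | true  = refl
    ... | false = sym (+-identityʳ x)

-- Lists enumerating a type

record Listing {A : Set} (xs : List A) : Set where
  field
    unique   : Unique xs
    complete : ∀ x → x ∈ xs

open Listing

allFin-listing : ∀ n → Listing (allFin n)
allFin-listing n = record { unique = Unique.allFin⁺ n ; complete = ∈-allFin }

concatMap-map : ∀ (f : A → B → C) xs ys →
                concatMap (λ x → map (f x) ys) xs ≡ cartesianProductWith f xs ys
concatMap-map f []       ys = refl
concatMap-map f (x ∷ xs) ys = cong (map (f x) ys ++_) (concatMap-map f xs ys)

cartesianProductWith-listing : ∀ (f : A → B → C) →
  (∀ {w x y z} → f w y ≡ f x z → w ≡ x × y ≡ z) → (∀ z → ∃₂ λ x y → z ≡ f x y) →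
  ∀ {xs ys} → Listing xs → Listing ys → Listing (cartesianProductWith f xs ys)
cartesianProductWith-listing f f-injective f-surjective Lxs Lys = record
  { unique   = Unique.cartesianProductWith⁺ f f-injective (unique Lxs) (unique Lys)
  ; complete = λ z → let x , y , z≡fxy = f-surjective z in
      subst (_∈ _) (sym z≡fxy) (∈-cartesianProductWith⁺ f (complete Lxs x) (complete Lys y))
  }

∑-select : ∀ {xs} {a : A} → Unique xs → a ∈ xs →
           (f : A → ℕ) → (∀ x → x ≢ a → f x ≡ 0) → ∑ xs f ≡ f a
∑-select {xs = x ∷ xs} (x∉xs ∷ _) (here refl) f f≡0 =
  trans (cong (f x +_) (∑-none x∉xs)) (+-identityʳ (f x))
  where
  ∑-none : ∀ {ys} → All (x ≢_) ys → ∑ ys f ≡ 0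
  ∑-none []                    = refl
  ∑-none {y ∷ ys} (x≢y ∷ x∉ys) = trans (cong (_+ ∑ ys f) (f≡0 y (x≢y ∘ sym))) (∑-none x∉ys)
∑-select {xs = x ∷ xs} (x∉xs ∷ u) (there a∈xs) f f≡0 =
  trans (cong (_+ ∑ xs f) (f≡0 x (All.lookup x∉xs a∈xs))) (∑-select u a∈xs f f≡0)

⌊⌋-true : ∀ {P : Set} (P? : Dec P) → P → ⌊ P? ⌋ ≡ true
⌊⌋-true P? p = trans (isYes≗does P?) (dec-true P? p)

⌊⌋-false : ∀ {P : Set} (P? : Dec P) → ¬ P → ⌊ P? ⌋ ≡ false
⌊⌋-false P? ¬p = trans (isYes≗does P?) (dec-false P? ¬p)

module _ (_≟_ : DecidableEquality A) where

  δ : A → A → ℕ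
  δ x y = if ⌊ x ≟ y ⌋ then 1 else 0

  δ-refl : ∀ x → δ x x ≡ 1
  δ-refl x rewrite ⌊⌋-true (x ≟ x) refl = refl

  δ-≢ : ∀ {x y} → x ≢ y → δ x y ≡ 0
  δ-≢ {x} {y} x≢y rewrite ⌊⌋-false (x ≟ y) x≢y = refl

  -- Write f x as Σ_b δ x (h b) * f x and exchange the sums: the inner sum counts the unique
  -- preimage of x under h, and f x ≡ 0 when there is none.
  ∑-image : ∀ (h : B → A) → (∀ {b b′} → h b ≡ h b′ → b ≡ b′) →
            ∀ {xs ys} → Listing xs → Listing ys →
            (f : A → ℕ) → (∀ x → f x ≡ 0 ⊎ ∃ λ b → x ≡ h b) → ∑ xs f ≡ ∑ ys (f ∘ h)
  ∑-image h h-injective {xs} {ys} Lxs Lys f f-supported = begin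
    ∑ xs f                                     ≡⟨ ∑-cong xs fibre ⟨
    ∑ xs (λ x → ∑ ys (λ b → δ x (h b) * f x))  ≡⟨ ∑-comm xs ys _ ⟩
    ∑ ys (λ b → ∑ xs (λ x → δ x (h b) * f x))  ≡⟨ ∑-cong ys point ⟩
    ∑ ys (f ∘ h)                               ∎
    where
    open ≡-Reasoning
    fibre : ∀ x → ∑ ys (λ b → δ x (h b) * f x) ≡ f x
    fibre x with f-supported x
    ... | inj₁ fx≡0 = begin
      ∑ ys (λ b → δ x (h b) * f x)  ≡⟨ ∑-*ʳ ys (λ b → δ x (h b)) (f x) ⟩
      ∑ ys (λ b → δ x (h b)) * f x  ≡⟨ cong (∑ ys (λ b → δ x (h b)) *_) fx≡0 ⟩
      ∑ ys (λ b → δ x (h b)) * 0    ≡⟨ *-zeroʳ (∑ ys (λ b → δ x (h b))) ⟩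
      0                             ≡⟨ fx≡0 ⟨
      f x                           ∎
    ... | inj₂ (b₀ , refl) = begin
      ∑ ys (λ b → δ (h b₀) (h b) * f (h b₀))
        ≡⟨ ∑-*ʳ ys (λ b → δ (h b₀) (h b)) (f (h b₀)) ⟩
      ∑ ys (λ b → δ (h b₀) (h b)) * f (h b₀)
        ≡⟨ cong (_* f (h b₀)) (∑-select (unique Lys) (complete Lys b₀) _ off-b₀) ⟩
      δ (h b₀) (h b₀) * f (h b₀)
        ≡⟨ cong (_* f (h b₀)) (δ-refl (h b₀)) ⟩
      1 * f (h b₀)
        ≡⟨ *-identityˡ (f (h b₀)) ⟩
      f (h b₀) ∎
      where
      off-b₀ : ∀ b → b ≢ b₀ → δ (h b₀) (h b) ≡ 0
      off-b₀ b b≢b₀ = δ-≢ (b≢b₀ ∘ sym ∘ h-injective)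
    point : ∀ b → ∑ xs (λ x → δ x (h b) * f x) ≡ f (h b)
    point b = begin
      ∑ xs (λ x → δ x (h b) * f x)  ≡⟨ ∑-select (unique Lxs) (complete Lxs (h b)) _ off-hb ⟩
      δ (h b) (h b) * f (h b)       ≡⟨ cong (_* f (h b)) (δ-refl (h b)) ⟩
      1 * f (h b)                   ≡⟨ *-identityˡ (f (h b)) ⟩
      f (h b)                       ∎
      where
      off-hb : ∀ x → x ≢ h b → δ x (h b) * f x ≡ 0
      off-hb x x≢hb = cong (_* f x) (δ-≢ x≢hb)

∏-involution : Listing xs → (φ : A → A) → (∀ x → φ (φ x) ≡ x) →
               (f : A → ℕ) → ∏ xs (f ∘ φ) ≡ ∏ xs f
∏-involution {xs = xs} L φ φφ f = trans (sym (∏-map φ xs f)) (product-↭ (map⁺ f map-φ-xs↭xs))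
  where
  φ-injective : ∀ {x y} → φ x ≡ φ y → x ≡ y
  φ-injective {x} {y} φx≡φy = trans (sym (φφ x)) (trans (cong φ φx≡φy) (φφ y))
  map-φ-xs↭xs : map φ xs ↭ xs
  map-φ-xs↭xs = ∼bag⇒↭ (unique∧set⇒bag (Unique.map⁺ φ-injective (unique L)) (unique L)
    λ {x} → mk⇔ (λ _ → complete L x)
                (λ _ → subst (_∈ map φ xs) (φφ x) (∈-map⁺ φ (complete L (φ x)))))

length-allFin : ∀ n → length (allFin n) ≡ n
length-allFin n = length-tabulate {n = n} id

length-concatMap-map : ∀ (f : A → B → C) xs ys →
                       length (concatMap (λ x → map (f x) ys) xs) ≡ length xs * length ys
length-concatMap-map f []       ys = refl
length-concatMap-map f (x ∷ xs) ys = trans (length-++ (map (f x) ys))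
  (cong₂ _+_ (length-map (f x) ys) (length-concatMap-map f xs ys))

length-allWords : ∀ q n → length (allWords q n) ≡ q ^ n
length-allWords q zero    = refl
length-allWords q (suc n) = trans (length-concatMap-map _∷_ (allFin q) (allWords q n))
                                  (cong₂ _*_ (length-allFin q) (length-allWords q n))

allWords-listing : ∀ q n → Listing (allWords q n)
allWords-listing q zero    = record { unique = [] ∷ [] ; complete = λ { [] → here refl } }
allWords-listing q (suc n) = subst Listing (sym (concatMap-map _∷_ (allFin q) (allWords q n)))
  (cartesianProductWith-listing _∷_ ∷-injective (λ { (x ∷ v) → x , v , refl })
                                (allFin-listing q) (allWords-listing q n))

⌊≟⌋-sym : ∀ {n} (x y : Fin n) → ⌊ x ≟F y ⌋ ≡ ⌊ y ≟F x ⌋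
⌊≟⌋-sym x y with x ≟F y
... | yes refl = sym (⌊⌋-true (x ≟F x) refl)
... | no  x≢y  = sym (⌊⌋-false (y ≟F x) (x≢y ∘ sym))

-- One resampling step

module Walks (q J : ℕ) .{{_ : NonZero q}}
             (bad : Word q J → Word q J → Bool) (bad-sym : ∀ v w → bad v w ≡ bad w v) where

  W : List (Word q J)
  W = allWords q J

  module Coordinate (j : Fin J) where

    step : Word q J → Fin q → Word q J
    step v c = v [ j ]≔ c

    stays badMove goodMove allowed : Word q J → Fin q → Bool
    stays v c    = ⌊ lookup v j ≟F c ⌋
    badMove v c  = not (stays v c) ∧ bad v (step v c)
    goodMove v c = not (stays v c) ∧ not (bad v (step v c))
    allowed v c  = stays v c ∨ not (bad v (step v c))

    badMoves : Word q J → ℕ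
    badMoves v = countB (badMove v) (allFin q)

    transfer : (Word q J → ℕ) → Word q J → ℕ
    transfer g v = ∑ (allFin q) (λ c → if allowed v c then g (step v c) else 0)

    ∑goodMove : (Word q J → ℕ) → Word q J → ℕ
    ∑goodMove g v = ∑ (allFin q) (λ c → if goodMove v c then g (step v c) else 0)

    follow : Word q J → Fin q → Word q J
    follow v c = if goodMove v c then step v c else v

    eqW-step : ∀ v c → eqW v (step v c) ≡ stays v c
    eqW-step v c with lookup v j ≟F c
    ... | yes refl = ⌊⌋-true (≡-dec _≟F_ v _) (sym ([]≔-lookup v j))
    ... | no  vⱼ≢c = ⌊⌋-false (≡-dec _≟F_ v _)
                              (λ v≡ → vⱼ≢c (trans (cong (λ w → lookup w j) v≡) (lookup∘update j v c)))

    ∑-stays : ∀ v (f : Fin q → ℕ) →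
              ∑ (allFin q) (λ c → if stays v c then f c else 0) ≡ f (lookup v j)
    ∑-stays v f = trans (∑-select (Unique.allFin⁺ q) (∈-allFin (lookup v j)) _ moved) unmoved
      where
      moved : ∀ c → c ≢ lookup v j → (if stays v c then f c else 0) ≡ 0
      moved c c≢vⱼ rewrite ⌊⌋-false (lookup v j ≟F c) (c≢vⱼ ∘ sym) = refl
      unmoved : (if stays v (lookup v j) then f (lookup v j) else 0) ≡ f (lookup v j)
      unmoved rewrite ⌊⌋-true (lookup v j ≟F lookup v j) refl = refl

    #¬goodMove : ∀ v → countB (not ∘ goodMove v) (allFin q) ≡ suc (badMoves v)
    #¬goodMove v = begin
      countB (not ∘ goodMove v) (allFin q)
        ≡⟨ countB-∑ (not ∘ goodMove v) (allFin q) ⟩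
      ∑ (allFin q) (λ c → if not (goodMove v c) then 1 else 0)
        ≡⟨ ∑-cong (allFin q) split ⟩
      ∑ (allFin q) (λ c → (if stays v c then 1 else 0) + (if badMove v c then 1 else 0))
        ≡⟨ ∑-+ (allFin q) _ _ ⟩
      ∑ (allFin q) (λ c → if stays v c then 1 else 0) + ∑ (allFin q) (λ c → if badMove v c then 1 else 0)
        ≡⟨ cong₂ _+_ (∑-stays v (λ _ → 1)) (sym (countB-∑ (badMove v) (allFin q))) ⟩
      suc (badMoves v) ∎
      where
      open ≡-Reasoning
      split : ∀ c → (if not (goodMove v c) then 1 else 0)
                    ≡ (if stays v c then 1 else 0) + (if badMove v c then 1 else 0)
      split c with stays v c | bad v (step v c)
      ... | true  | _     = refl
      ... | false | true  = refl
      ... | false | false = refl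

    transfer-split : ∀ g v → transfer g v ≡ g v + ∑goodMove g v
    transfer-split g v = begin
      transfer g v
        ≡⟨ ∑-cong (allFin q) split ⟩
      ∑ (allFin q) (λ c → (if stays v c then g (step v c) else 0) + (if goodMove v c then g (step v c) else 0))
        ≡⟨ ∑-+ (allFin q) _ _ ⟩
      ∑ (allFin q) (λ c → if stays v c then g (step v c) else 0) + ∑goodMove g v
        ≡⟨ cong (_+ ∑goodMove g v) (trans (∑-stays v (g ∘ step v)) (cong g ([]≔-lookup v j))) ⟩
      g v + ∑goodMove g v ∎
      where
      open ≡-Reasoning
      split : ∀ c → (if allowed v c then g (step v c) else 0)
                    ≡ (if stays v c then g (step v c) else 0) + (if goodMove v c then g (step v c) else 0)
      split c with stays v c | bad v (step v c)
      ... | true  | _     = sym (+-identityʳ _)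
      ... | false | true  = refl
      ... | false | false = refl

    amgm-vertex : ∀ g v → q ^ q * ∏ (allFin q) (g ∘ follow v)
                            ≤ suc (badMoves v) ^ suc (badMoves v) * transfer g v ^ q
    amgm-vertex g v = begin
      q ^ q * ∏ (allFin q) (g ∘ follow v)
        ≡⟨ cong₂ (λ n P → n ^ n * P) (length-allFin q) (∏-cong (allFin q) follow-split) ⟨
      length (allFin q) ^ length (allFin q) * ∏ (allFin q) (λ c → if goodMove v c then g (step v c) else g v)
        ≤⟨ amgm-weighted (allFin q) (goodMove v) (g ∘ step v) (g v) (#¬goodMove v) ⟩
      s ^ s * (g v + ∑goodMove g v) ^ length (allFin q)
        ≡⟨ cong₂ (λ x n → s ^ s * x ^ n) (sym (transfer-split g v)) (length-allFin q) ⟩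
      s ^ s * transfer g v ^ q ∎
      where
      open ≤-Reasoning
      s = suc (badMoves v)
      follow-split : ∀ c → (if goodMove v c then g (step v c) else g v) ≡ g (follow v c)
      follow-split c = sym (if-float g (goodMove v c))

    1+badMoves≤q : ∀ v → suc (badMoves v) ≤ q
    1+badMoves≤q v = subst (suc (badMoves v) ≤_) moves≡q (m≤n+m _ (countB (goodMove v) (allFin q)))
      where
      moves≡q : countB (goodMove v) (allFin q) + suc (badMoves v) ≡ q
      moves≡q = trans (cong (countB (goodMove v) (allFin q) +_) (sym (#¬goodMove v)))
                      (trans (countB-partition (goodMove v) (allFin q)) (length-allFin q))

    vertex-bound : ∀ g v → (q ^ q * ∏ (allFin q) (g ∘ follow v)) ^ (q ∸ 1)
                             ≤ q ^ (q * badMoves v) * (transfer g v ^ q) ^ (q ∸ 1)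
    vertex-bound g v = begin
      (q ^ q * ∏ (allFin q) (g ∘ follow v)) ^ k  ≤⟨ ^-monoˡ-≤ k (amgm-vertex g v) ⟩
      (s ^ s * transfer g v ^ q) ^ k             ≡⟨ ^-distribʳ-* (s ^ s) (transfer g v ^ q) k ⟩
      (s ^ s) ^ k * (transfer g v ^ q) ^ k       ≤⟨ *-monoˡ-≤ _ (selfPower-mono (1+badMoves≤q v)) ⟩
      q ^ (q * badMoves v) * (transfer g v ^ q) ^ k ∎
      where
      open ≤-Reasoning
      k = q ∸ 1
      s = suc (badMoves v)

    step-back : ∀ v c → step (step v c) (lookup v j) ≡ v
    step-back v c = trans ([]≔-idempotent v j) ([]≔-lookup v j)

    step-injective : ∀ v {c c′} → step v c ≡ step v c′ → c ≡ c′
    step-injective v {c} {c′} e =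
      trans (sym (lookup∘update j v c)) (trans (cong (λ w → lookup w j) e) (lookup∘update j v c′))

    goodMove-back : ∀ v c → goodMove (step v c) (lookup v j) ≡ goodMove v c
    goodMove-back v c = cong₂ (λ s b → not s ∧ not b)
      (trans (cong (λ x → ⌊ x ≟F lookup v j ⌋) (lookup∘update j v c)) (⌊≟⌋-sym c (lookup v j)))
      (trans (cong (bad (step v c)) (step-back v c)) (bad-sym (step v c) v))

    hop : Word q J × Fin q → Word q J × Fin q
    hop (v , c) = if goodMove v c then (step v c , lookup v j) else (v , c)

    hop-involutive : ∀ vc → hop (hop vc) ≡ vc
    hop-involutive (v , c) with goodMove v c in e
    ... | true  rewrite goodMove-back v c | e = cong₂ _,_ (step-back v c) (lookup∘update j v c)
    ... | false rewrite e = refl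

    moves : List (Word q J × Fin q)
    moves = concatMap (λ v → map (v ,_) (allFin q)) W

    moves-listing : Listing moves
    moves-listing = subst Listing (sym (concatMap-map _,_ W (allFin q)))
      (cartesianProductWith-listing _,_ (λ e → ,-injectiveˡ e , ,-injectiveʳ e) (λ (v , c) → v , c , refl)
                                    (allWords-listing q J) (allFin-listing q))

    ∏-moves : ∀ f → ∏ moves f ≡ ∏ W (λ v → ∏ (allFin q) (λ c → f (v , c)))
    ∏-moves f = trans (∏-concatMap _ W f) (∏-cong W (λ v → ∏-map (v ,_) (allFin q) f))

    ∏-follow : ∀ g → ∏ W (λ v → ∏ (allFin q) (g ∘ follow v)) ≡ ∏ W g ^ q
    ∏-follow g = begin
      ∏ W (λ v → ∏ (allFin q) (g ∘ follow v))
        ≡⟨ ∏-cong W (λ v → ∏-cong (allFin q) (λ c → cong g (if-float proj₁ (goodMove v c)))) ⟨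
      ∏ W (λ v → ∏ (allFin q) (λ c → g (proj₁ (hop (v , c)))))
        ≡⟨ ∏-moves (g ∘ proj₁ ∘ hop) ⟨
      ∏ moves (g ∘ proj₁ ∘ hop)
        ≡⟨ ∏-involution moves-listing hop hop-involutive (g ∘ proj₁) ⟩
      ∏ moves (g ∘ proj₁)
        ≡⟨ ∏-moves (g ∘ proj₁) ⟩
      ∏ W (λ v → ∏ (allFin q) (λ _ → g v))
        ≡⟨ ∏-cong W (λ v → trans (∏-const (allFin q) (g v)) (cong (g v ^_) (length-allFin q))) ⟩
      ∏ W (λ v → g v ^ q)
        ≡⟨ ∏-^ W g q ⟩
      ∏ W g ^ q ∎
      where open ≡-Reasoning

    dirEdge-step : ∀ v c → dirEdge j v (step v c) ≡ not (stays v c)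
    dirEdge-step v c = begin
      not ⌊ lookup v j ≟F lookup (step v c) j ⌋ ∧ eqW (step v c) (v [ j ]≔ lookup (step v c) j)
        ≡⟨ cong (λ x → not ⌊ lookup v j ≟F x ⌋ ∧ eqW (step v c) (step v x)) (lookup∘update j v c) ⟩
      not (stays v c) ∧ eqW (step v c) (step v c)
        ≡⟨ cong (not (stays v c) ∧_) (⌊⌋-true (≡-dec _≟F_ (step v c) (step v c)) refl) ⟩
      not (stays v c) ∧ true
        ≡⟨ ∧-identityʳ (not (stays v c)) ⟩
      not (stays v c) ∎
      where open ≡-Reasoning

    edges-from : ∀ v → countB (λ w → dirEdge j v w ∧ bad v w) W ≡ badMoves v
    edges-from v = begin
      countB (λ w → dirEdge j v w ∧ bad v w) W
        ≡⟨ countB-∑ _ W ⟩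
      ∑ W (λ w → if dirEdge j v w ∧ bad v w then 1 else 0)
        ≡⟨ ∑-image (≡-dec _≟F_) (step v) (step-injective v) (allWords-listing q J) (allFin-listing q)
                   _ edge-at-step ⟩
      ∑ (allFin q) (λ c → if dirEdge j v (step v c) ∧ bad v (step v c) then 1 else 0)
        ≡⟨ ∑-cong (allFin q) (λ c → cong (λ s → if s ∧ bad v (step v c) then 1 else 0)
                                         (dirEdge-step v c)) ⟩
      ∑ (allFin q) (λ c → if badMove v c then 1 else 0)
        ≡⟨ countB-∑ (badMove v) (allFin q) ⟨
      badMoves v ∎
      where
      open ≡-Reasoning
      edge-at-step : ∀ w → (if dirEdge j v w ∧ bad v w then 1 else 0) ≡ 0 ⊎ ∃ λ c → w ≡ step v c
      edge-at-step w with ≡-dec _≟F_ w (step v (lookup w j))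
      ... | yes w≡ = inj₂ (lookup w j , w≡)
      ... | no  _  = inj₁ (cong (λ b → if b ∧ bad v w then 1 else 0)
                                (∧-zeroʳ (not ⌊ lookup v j ≟F lookup w j ⌋)))

    badDir≡∑badMoves : badDir q J bad j ≡ ∑ W badMoves
    badDir≡∑badMoves = trans (countB-concatMap _ (λ v → map (v ,_) W) W)
                             (∑-cong W (λ v → trans (countB-map _ (v ,_) W) (edges-from v)))

    product-bound : ∀ g → ((q ^ q) ^ length W * ∏ W g ^ q) ^ (q ∸ 1)
                            ≤ q ^ (q * badDir q J bad j) * (∏ W (transfer g) ^ q) ^ (q ∸ 1)
    product-bound g = begin
      ((q ^ q) ^ length W * ∏ W g ^ q) ^ k
        ≡⟨ cong (λ P → ((q ^ q) ^ length W * P) ^ k) (∏-follow g) ⟨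
      ((q ^ q) ^ length W * ∏ W (λ v → ∏ (allFin q) (g ∘ follow v))) ^ k
        ≡⟨ cong (λ Q → (Q * ∏ W (λ v → ∏ (allFin q) (g ∘ follow v))) ^ k) (∏-const W (q ^ q)) ⟨
      (∏ W (λ _ → q ^ q) * ∏ W (λ v → ∏ (allFin q) (g ∘ follow v))) ^ k
        ≡⟨ cong (_^ k) (∏-* W (λ _ → q ^ q) (λ v → ∏ (allFin q) (g ∘ follow v))) ⟨
      ∏ W (λ v → q ^ q * ∏ (allFin q) (g ∘ follow v)) ^ k
        ≡⟨ ∏-^ W (λ v → q ^ q * ∏ (allFin q) (g ∘ follow v)) k ⟨
      ∏ W (λ v → (q ^ q * ∏ (allFin q) (g ∘ follow v)) ^ k)
        ≤⟨ ∏-mono-≤ W (vertex-bound g) ⟩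
      ∏ W (λ v → q ^ (q * badMoves v) * (transfer g v ^ q) ^ k)
        ≡⟨ ∏-* W (λ v → q ^ (q * badMoves v)) (λ v → (transfer g v ^ q) ^ k) ⟩
      ∏ W (λ v → q ^ (q * badMoves v)) * ∏ W (λ v → (transfer g v ^ q) ^ k)
        ≡⟨ cong₂ _*_ (∏-^-∑ W q (λ v → q * badMoves v))
                     (trans (∏-^ W (λ v → transfer g v ^ q) k) (cong (_^ k) (∏-^ W (transfer g) q))) ⟩
      q ^ ∑ W (λ v → q * badMoves v) * (∏ W (transfer g) ^ q) ^ k
        ≡⟨ cong (λ e → q ^ e * (∏ W (transfer g) ^ q) ^ k) (∑-*ˡ W q badMoves) ⟩
      q ^ (q * ∑ W badMoves) * (∏ W (transfer g) ^ q) ^ k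
        ≡⟨ cong (λ B → q ^ (q * B) * (∏ W (transfer g) ^ q) ^ k) badDir≡∑badMoves ⟨
      q ^ (q * badDir q J bad j) * (∏ W (transfer g) ^ q) ^ k ∎
      where
      open ≤-Reasoning
      k = q ∸ 1

    transfer-bound : ∀ g → q ^ dirTotal q J * ∏ W g ^ (q ∸ 1)
                             ≤ ∏ W (transfer g) ^ (q ∸ 1) * q ^ badDir q J bad j
    transfer-bound g = ^-cancelʳ-≤ q (begin
      (q ^ (q ^ J * k) * ∏ W g ^ k) ^ q
        ≡⟨ ^-distribʳ-* (q ^ (q ^ J * k)) (∏ W g ^ k) q ⟩
      (q ^ (q ^ J * k)) ^ q * (∏ W g ^ k) ^ q
        ≡⟨ cong₂ _*_ qᴰ-reshape (^-^-comm (∏ W g) k q) ⟩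
      ((q ^ q) ^ length W) ^ k * (∏ W g ^ q) ^ k
        ≡⟨ ^-distribʳ-* ((q ^ q) ^ length W) (∏ W g ^ q) k ⟨
      ((q ^ q) ^ length W * ∏ W g ^ q) ^ k
        ≤⟨ product-bound g ⟩
      q ^ (q * b) * (∏ W (transfer g) ^ q) ^ k
        ≡⟨ cong₂ _*_ (trans (cong (q ^_) (*-comm q b)) (sym (^-*-assoc q b q)))
                     (^-^-comm (∏ W (transfer g)) q k) ⟩
      (q ^ b) ^ q * (∏ W (transfer g) ^ k) ^ q
        ≡⟨ *-comm ((q ^ b) ^ q) ((∏ W (transfer g) ^ k) ^ q) ⟩
      (∏ W (transfer g) ^ k) ^ q * (q ^ b) ^ q
        ≡⟨ ^-distribʳ-* (∏ W (transfer g) ^ k) (q ^ b) q ⟨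
      (∏ W (transfer g) ^ k * q ^ b) ^ q ∎)
      where
      open ≤-Reasoning
      k = q ∸ 1
      b = badDir q J bad j
      qᴰ-reshape : (q ^ (q ^ J * k)) ^ q ≡ ((q ^ q) ^ length W) ^ k
      qᴰ-reshape = begin-equality
        (q ^ (q ^ J * k)) ^ q     ≡⟨ ^-^-comm q (q ^ J * k) q ⟩
        (q ^ q) ^ (q ^ J * k)     ≡⟨ ^-*-assoc (q ^ q) (q ^ J) k ⟨
        ((q ^ q) ^ q ^ J) ^ k     ≡⟨ cong (λ n → ((q ^ q) ^ n) ^ k) (length-allWords q J) ⟨
        ((q ^ q) ^ length W) ^ k  ∎

  -- The walk

  open Coordinate

  count : ∀ {T} → (Fin T → Fin J) → Word q J → ℕ
  count {T} σ v = countB (goodWalk bad σ v) (allWords q T)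

  count-suc : ∀ {T} (σ : Fin (suc T) → Fin J) v →
              count σ v ≡ transfer (σ Fin.zero) (count (σ ∘ Fin.suc)) v
  count-suc {T} σ v = begin
    count σ v
      ≡⟨ countB-concatMap (goodWalk bad σ v) (λ c → map (c ∷_) (allWords q T)) (allFin q) ⟩
    ∑ (allFin q) (λ c → countB (goodWalk bad σ v) (map (c ∷_) (allWords q T)))
      ≡⟨ ∑-cong (allFin q) (λ c → trans (countB-map (goodWalk bad σ v) (c ∷_) (allWords q T))
                                        (countB-∧ _ _ (allWords q T))) ⟩
    ∑ (allFin q) (λ c → if eqW v (step j v c) ∨ not (bad v (step j v c)) then rest (step j v c) else 0)
      ≡⟨ ∑-cong (allFin q) (λ c → cong (λ a → if a then rest (step j v c) else 0)
                                       (cong (_∨ not (bad v (step j v c))) (eqW-step j v c))) ⟩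
    transfer j rest v ∎
    where
    open ≡-Reasoning
    j = σ Fin.zero
    rest = count (σ ∘ Fin.suc)

  badSum-suc : ∀ {T} (σ : Fin (suc T) → Fin J) →
               badSum q J (suc T) bad σ ≡ badDir q J bad (σ Fin.zero) + badSum q J T bad (σ ∘ Fin.suc)
  badSum-suc {T} σ = cong (λ bs → badDir q J bad (σ Fin.zero) + sum bs)
                          (trans (map-tabulate Fin.suc b) (sym (map-tabulate id (b ∘ Fin.suc))))
    where
    b = λ t → badDir q J bad (σ t)

  walk-bound : ∀ T (σ : Fin T → Fin J) →
               q ^ (T * dirTotal q J) ≤ ∏ W (count σ) ^ (q ∸ 1) * q ^ badSum q J T bad σ
  walk-bound zero    σ = ≤-reflexive (sym (begin-equality
    ∏ W (λ _ → 1) ^ (q ∸ 1) * 1  ≡⟨ *-identityʳ _ ⟩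
    ∏ W (λ _ → 1) ^ (q ∸ 1)      ≡⟨ cong (_^ (q ∸ 1)) (trans (∏-const W 1) (^-zeroˡ (length W))) ⟩
    1 ^ (q ∸ 1)                  ≡⟨ ^-zeroˡ (q ∸ 1) ⟩
    1                            ∎))
    where open ≤-Reasoning
  walk-bound (suc T) σ = begin
    q ^ (D + T * D)             ≡⟨ ^-distribˡ-+-* q D (T * D) ⟩
    q ^ D * q ^ (T * D)         ≤⟨ *-monoʳ-≤ (q ^ D) (walk-bound T σ′) ⟩
    q ^ D * (P′ ^ k * q ^ B′)   ≡⟨ *-assoc (q ^ D) (P′ ^ k) (q ^ B′) ⟨
    q ^ D * P′ ^ k * q ^ B′     ≤⟨ *-monoˡ-≤ (q ^ B′) (transfer-bound j (count σ′)) ⟩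
    TP′ ^ k * q ^ b * q ^ B′    ≡⟨ *-assoc (TP′ ^ k) (q ^ b) (q ^ B′) ⟩
    TP′ ^ k * (q ^ b * q ^ B′)  ≡⟨ cong (TP′ ^ k *_) (^-distribˡ-+-* q b B′) ⟨
    TP′ ^ k * q ^ (b + B′)      ≡⟨ cong₂ (λ P B → P ^ k * q ^ B) TP′≡P (sym (badSum-suc σ)) ⟩
    ∏ W (count σ) ^ k * q ^ badSum q J (suc T) bad σ ∎
    where
    open ≤-Reasoning
    D = dirTotal q J
    k = q ∸ 1
    j = σ Fin.zero
    σ′ = σ ∘ Fin.suc
    b = badDir q J bad j
    B′ = badSum q J T bad σ′
    P′ = ∏ W (count σ′)
    TP′ = ∏ W (transfer j (count σ′))
    TP′≡P : TP′ ≡ ∏ W (count σ)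
    TP′≡P = ∏-cong W (λ v → sym (count-suc σ v))

  goodCount≡∑count : ∀ T (σ : Fin T → Fin J) → goodCount q J T bad σ ≡ ∑ W (count σ)
  goodCount≡∑count T σ = trans (countB-concatMap _ (λ v → map (v ,_) (allWords q T)) W)
                               (∑-cong W (λ v → countB-map _ (v ,_) (allWords q T)))

  goodCount-bound : ∀ T (σ : Fin T → Fin J) →
                    q ^ (J * dirTotal q J) * ∏ W (count σ) ^ (q ∸ 1) ≤ goodCount q J T bad σ ^ dirTotal q J
  goodCount-bound T σ = begin
    q ^ (J * (q ^ J * k)) * P ^ k  ≡⟨ cong (_* P ^ k) qᴶᴰ≡Nᴺᵏ ⟩
    (N ^ N) ^ k * P ^ k            ≡⟨ ^-distribʳ-* (N ^ N) P k ⟨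
    (N ^ N * P) ^ k                ≤⟨ ^-monoˡ-≤ k (amgm-∑∏ W (count σ)) ⟩
    (∑ W (count σ) ^ N) ^ k        ≡⟨ cong (λ G → (G ^ N) ^ k) (goodCount≡∑count T σ) ⟨
    (G ^ N) ^ k                    ≡⟨ ^-*-assoc G N k ⟩
    G ^ (N * k)                    ≡⟨ cong (λ n → G ^ (n * k)) (length-allWords q J) ⟩
    G ^ (q ^ J * k)                ∎
    where
    open ≤-Reasoning
    k = q ∸ 1
    N = length W
    P = ∏ W (count σ)
    G = goodCount q J T bad σ
    qᴶᴰ≡Nᴺᵏ : q ^ (J * (q ^ J * k)) ≡ (N ^ N) ^ k
    qᴶᴰ≡Nᴺᵏ = begin-equality
      q ^ (J * (q ^ J * k))  ≡⟨ cong (q ^_) (*-assoc J (q ^ J) k) ⟨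
      q ^ (J * q ^ J * k)    ≡⟨ ^-*-assoc q (J * q ^ J) k ⟨
      (q ^ (J * q ^ J)) ^ k  ≡⟨ cong (_^ k) (^-*-assoc q J (q ^ J)) ⟨
      ((q ^ J) ^ q ^ J) ^ k  ≡⟨ cong (λ n → (n ^ n) ^ k) (length-allWords q J) ⟨
      (N ^ N) ^ k            ∎

-- 1 ≤ J is needed only when q = 0, and 1 ≤ T not at all.
lemma6p5 : (q J T : ℕ) → 1 ≤ J → 1 ≤ T →
           (bad : Word q J → Word q J → Bool) →
           (∀ v w → bad v w ≡ bad w v) →
           (σ : Fin T → Fin J) →
           q ^ ((J + T) * dirTotal q J)
             ≤ goodCount q J T bad σ ^ dirTotal q J * q ^ badSum q J T bad σ
-- With no symbols there are no words, so every badDir vanishes and both sides are 1.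
lemma6p5 zero    (suc J) T _ _ bad _ σ = ≤-reflexive (begin
  0 ^ ((suc J + T) * 0)
    ≡⟨ cong (0 ^_) (*-zeroʳ (suc J + T)) ⟩
  1
    ≡⟨ cong (λ n → 1 * 0 ^ n) (∑-zero (allFin T)) ⟨
  goodCount 0 (suc J) T bad σ ^ 0 * 0 ^ badSum 0 (suc J) T bad σ ∎)
  where open ≡-Reasoning
lemma6p5 q@(suc _) J T _ _ bad bad-sym σ = begin
  q ^ ((J + T) * D)                     ≡⟨ cong (q ^_) (*-distribʳ-+ D J T) ⟩
  q ^ (J * D + T * D)                   ≡⟨ ^-distribˡ-+-* q (J * D) (T * D) ⟩
  q ^ (J * D) * q ^ (T * D)             ≤⟨ *-monoʳ-≤ (q ^ (J * D)) (walk-bound T σ) ⟩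
  q ^ (J * D) * (P ^ (q ∸ 1) * q ^ b)   ≡⟨ *-assoc (q ^ (J * D)) (P ^ (q ∸ 1)) (q ^ b) ⟨
  q ^ (J * D) * P ^ (q ∸ 1) * q ^ b     ≤⟨ *-monoˡ-≤ (q ^ b) (goodCount-bound T σ) ⟩
  goodCount q J T bad σ ^ D * q ^ b     ∎
  where
  open Walks q J bad bad-sym
  open ≤-Reasoning
  D = dirTotal q J
  P = ∏ W (count σ)
  b = badSum q J T bad σ
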